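{- For all positive integers $d$ and $\ell$, the following hold. (1) If $\ell \geq 2$, then for all integers $q \geq d+2$, an OR relation of arity $d\ell$ is definable from $\mathrm{NUR}_{d,\ell}^q$. (2) For all integers $q \geq d+1$, an OR relation of arity $d\ell-1$ is definable from $\mathrm{NUR}_{d,\ell}^q$. (3) For all integers $q \geq d$, an OR relation of arity $(d-1)\ell$ is definable from $\mathrm{NUR}_{d,\ell}^q$.
   Context: For positive integers $d,\ell$ and $q\ge d$, view $d\ell$-tuples over $[q]$ as $d\times\ell$ matrices with entries indexed by $[d]\times[\ell]$. $\mathrm{UR}_{d,\ell}^q\subseteq[q]^{d\times\ell}$ is the set of matrices $M$ such that the sets $\{M_{i,j}: i\in[d]\}$, $j\in[\ell]$, are all equal and of size $d$; $\mathrm{NUR}_{d,\ell}^q=[q]^{d\times\ell}\setminus\mathrm{UR}_{d,\ell}^q$, a relation of arity $d\ell$. An OR relation of arity $k$ is definable from a relation $R\subseteq[q]^r$ if there exist sets $D_1,\dots,D_r\subseteq[q]$, exactly $k$ of size $2$ and the others of size $1$, such that $|(D_1\times\cdots\times D_r)\cap R|=2^k-1$. -}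

module Defs where

open import Data.Nat using (ℕ; _*_; _^_; _∸_)
open import Data.Nat.Properties using (_≟_)
open import Data.Fin using (Fin; combine)
open import Data.Fin.Subset using (Subset; _∈_; ∣_∣)
open import Data.Vec using (Vec; lookup)
open import Data.List using (List; length; filter; allFin)
open import Data.List.Membership.Propositional using () renaming (_∈_ to _∈ₗ_)
open import Data.List.Relation.Unary.Unique.Propositional using (Unique)
open import Data.Product using (Σ; ∃; _×_)
open import Data.Sum using (_⊎_)
open import Function.Definitions using (Injective)
open import Function.Bundles using (_⇔_)
open import Relation.Binary.PropositionalEquality using (_≡_)
open import Relation.Unary using (Pred)
open import Level using (0ℓ)

Relation : ℕ → ℕ → Set₁
Relation q r = Pred (Vec (Fin q) r) 0ℓ

-- A d×ℓ matrix is a tuple of length d*ℓ; entry (i,j) is at position combine i j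
-- (a fixed bijection [d]×[ℓ] ≅ [dℓ]).
entry : ∀ {q} d ℓ → Vec (Fin q) (d * ℓ) → Fin d → Fin ℓ → Fin q
entry d ℓ v i j = lookup v (combine i j)

-- UR: every column {M_{i,j} : i ∈ [d]} has size d (entries pairwise distinct),
-- and all columns are equal as sets.
UR : ∀ q d ℓ → Relation q (d * ℓ)
UR q d ℓ v =
  (∀ (j : Fin ℓ) → Injective _≡_ _≡_ (λ i → entry d ℓ v i j))
  × (∀ (j j' : Fin ℓ) (i : Fin d) → ∃ λ i' → entry d ℓ v i' j' ≡ entry d ℓ v i j)

NUR : ∀ q d ℓ → Relation q (d * ℓ)
NUR q d ℓ v = UR q d ℓ v → Data.Empty.⊥
  where import Data.Empty

HasSize : ∀ {A : Set} → Pred A 0ℓ → ℕ → Set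
HasSize {A} S n = Σ (List A) λ L → Unique L × length L ≡ n × (∀ x → (x ∈ₗ L) ⇔ S x)

ORDefinable : ∀ {q r} → ℕ → Relation q r → Set
ORDefinable {q} {r} k R =
  Σ (Fin r → Subset q) λ D →
      (∀ i → ∣ D i ∣ ≡ 1 ⊎ ∣ D i ∣ ≡ 2)
    × length (filter (λ i → ∣ D i ∣ ≟ 2) (allFin r)) ≡ k
    × HasSize (λ v → (∀ i → lookup v i ∈ D i) × R v) (2 ^ k ∸ 1)

-- A box D₁ × ⋯ × D_{dℓ} with sides of size 1 or 2 that contains exactly one UR matrix u meets
-- NUR in the 2^k − 1 points other than u, where k is the number of two-element sides: an OR
-- relation of arity k. Each box used below gives entry (i , j) the side {b, b + 1} at the first
-- k positions in row-major order and {b} elsewhere, where b is i or i + 1. Uniqueness of u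
-- rests on one observation: in an injective column whose i-th entry lies in {s + i, s + i + 1},
-- a raised entry forces the next one to be raised, so a single low entry at the bottom lowers
-- the whole column and a single high entry at the top raises it. Since all columns of a UR
-- matrix have the same set of entries, such a bound obtained for one column transfers to all.

module Submission where

open import Defs
open import Data.Nat
  using (ℕ; zero; suc; _+_; _*_; _∸_; _^_; _≤_; _<_; _<?_; z≤n; s≤s; s<s⁻¹; pred; NonZero)
open import Data.Nat.Properties using (_≟_)
import Data.Nat.Properties as ℕ
open import Data.Fin using (Fin; zero; suc; toℕ; fromℕ; combine; remQuot)
import Data.Fin.Properties as Fin
open import Data.Fin.Subset using (Subset; inside; outside; ⁅_⁆; _∪_; ∣_∣; _∈_)
open import Data.Fin.Subset.Properties
  using (∣⁅x⁆∣≡1; ∪-idem; ∪-identityˡ; ∪-identityʳ; x∈⁅x⁆; x∈⁅y⁆⇒x≡y; x∈p∪q⁻; x∈p∪q⁺)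
open import Data.Nat.DivMod using (_mod_; m<n⇒m%n≡m)
open import Data.Vec using (Vec; []; _∷_; lookup; head; tail)
import Data.Vec.Properties as Vec
open import Data.Vec.Base using () renaming (here to hereₛ; there to thereₛ)
open import Data.List using (List; []; _∷_; length; filter; allFin; map; tabulate; cartesianProductWith)
import Data.List.Properties as List
open import Data.List.Membership.Propositional using () renaming (_∈_ to _∈ₗ_)
open import Data.List.Membership.Propositional.Properties
  using (∈-map⁺; ∈-map⁻; ∈-filter⁺; ∈-filter⁻; ∈-cartesianProductWith⁺; ∈-cartesianProductWith⁻)
open import Data.List.Relation.Unary.Any using (here; there)
import Data.List.Relation.Unary.All as All
import Data.List.Relation.Unary.All.Properties as All
open import Data.List.Relation.Unary.Unique.Propositional using (Unique; []; _∷_)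
import Data.List.Relation.Unary.Unique.Propositional.Properties as Unique
open import Data.Product using (∃; _×_; _,_; proj₁; proj₂; uncurry)
open import Data.Sum using (_⊎_; inj₁; inj₂; [_,_]′)
open import Data.Empty using (⊥-elim)
open import Function using (_∘_; id; case_of_)
open import Function.Definitions using (Injective)
open import Function.Bundles using (_⇔_; mk⇔; Equivalence)
open import Relation.Binary using (DecidableEquality)
open import Relation.Binary.PropositionalEquality
  using (_≡_; _≢_; refl; sym; trans; cong; cong₂; subst; ≢-sym; module ≡-Reasoning)
open import Relation.Nullary using (¬_; yes; no; ¬?; does)
open import Relation.Nullary.Decidable using (decidable-stable; toSum)
open import Relation.Unary using (Pred; Decidable)
open import Data.Bool using (true; false)
open import Level using (0ℓ)

open Equivalence using (to; from)

private
  variable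
    A : Set
    m n q r : ℕ

HasSize-resp : {S T : Pred A 0ℓ} → (∀ x → S x ⇔ T x) → m ≡ n → HasSize S m → HasSize T n
HasSize-resp S⇔T refl (L , unique , length≡ , ∈L⇔S) =
  L , unique , length≡ , λ x → mk⇔ (to (S⇔T x) ∘ to (∈L⇔S x)) (from (∈L⇔S x) ∘ from (S⇔T x))

length-remove : (_≟ₐ_ : DecidableEquality A) {u : A} {L : List A} → Unique L → u ∈ₗ L →
                suc (length (filter (λ x → ¬? (x ≟ₐ u)) L)) ≡ length L
length-remove _≟ₐ_ {u} (x∉xs ∷ _) (here refl) =
  cong (suc ∘ length) (trans (List.filter-reject ≢u? (λ u≢u → u≢u refl))
                             (List.filter-all ≢u? (All.map ≢-sym x∉xs)))
  where ≢u? = λ x → ¬? (x ≟ₐ u)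
length-remove _≟ₐ_ {u} (x∉xs ∷ xs!) (there u∈xs) =
  trans (cong (suc ∘ length) (List.filter-accept (λ x → ¬? (x ≟ₐ u)) (All.lookup x∉xs u∈xs)))
        (cong suc (length-remove _≟ₐ_ xs! u∈xs))

HasSize-remove : DecidableEquality A → {S : Pred A 0ℓ} {u : A} →
                 HasSize S n → S u → HasSize (λ x → S x × x ≢ u) (n ∸ 1)
HasSize-remove _≟ₐ_ {u = u} (L , L! , refl , ∈L⇔S) Su =
  filter ≢u? L , Unique.filter⁺ ≢u? L! , cong pred (length-remove _≟ₐ_ L! (from (∈L⇔S u) Su)) ,
  λ x → mk⇔ (λ x∈ → let x∈L , x≢u = ∈-filter⁻ ≢u? x∈ in to (∈L⇔S x) x∈L , x≢u)
            (λ (Sx , x≢u) → ∈-filter⁺ ≢u? (from (∈L⇔S x) Sx) x≢u)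
  where ≢u? = λ x → ¬? (x ≟ₐ u)

∈-map-suc⁻ : ∀ {n} {x : Fin n} {L : List (Fin n)} → suc x ∈ₗ map suc L → x ∈ₗ L
∈-map-suc⁻ {n} x∈ with _ , y∈ , refl ← ∈-map⁻ (Data.Fin.suc {n}) x∈ = y∈

zero∉map-suc : ∀ {n} {L : List (Fin n)} → ¬ (zero ∈ₗ map suc L)
zero∉map-suc {n} zero∈ = Fin.0≢1+n (proj₂ (proj₂ (∈-map⁻ (Data.Fin.suc {n}) zero∈)))

HasSize-∈ : (p : Subset n) → HasSize (_∈ p) ∣ p ∣
HasSize-∈ [] = [] , [] , refl , λ ()
HasSize-∈ (inside ∷ p) with L , L! , ∣L∣ , ∈L⇔∈p ← HasSize-∈ p =
  zero ∷ map suc L , All.map⁺ (All.universal (λ _ ()) L) ∷ Unique.map⁺ Fin.suc-injective L! ,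
  cong suc (trans (List.length-map suc L) ∣L∣) , λ where
    zero    → mk⇔ (λ _ → hereₛ) (λ _ → here refl)
    (suc x) → mk⇔ (λ { (there x∈) → thereₛ (to (∈L⇔∈p x) (∈-map-suc⁻ x∈)) })
                  (λ { (thereₛ x∈p) → there (∈-map⁺ suc (from (∈L⇔∈p x) x∈p)) })
HasSize-∈ (outside ∷ p) with L , L! , ∣L∣ , ∈L⇔∈p ← HasSize-∈ p =
  map suc L , Unique.map⁺ Fin.suc-injective L! , trans (List.length-map suc L) ∣L∣ , λ where
    zero    → mk⇔ (λ zero∈ → ⊥-elim (zero∉map-suc zero∈)) (λ ())
    (suc x) → mk⇔ (λ x∈ → thereₛ (to (∈L⇔∈p x) (∈-map-suc⁻ x∈)))
                  (λ { (thereₛ x∈p) → ∈-map⁺ suc (from (∈L⇔∈p x) x∈p) })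

length-cartesianProductWith : {B C : Set} (f : A → B → C) (xs : List A) (ys : List B) →
                              length (cartesianProductWith f xs ys) ≡ length xs * length ys
length-cartesianProductWith f []       ys = refl
length-cartesianProductWith f (x ∷ xs) ys =
  trans (List.length-++ (map (f x) ys))
        (cong₂ _+_ (List.length-map (f x) ys) (length-cartesianProductWith f xs ys))

HasSize-∷ : {S : Pred A 0ℓ} {T : Pred (Vec A r) 0ℓ} →
            HasSize S m → HasSize T n → HasSize (λ v → S (head v) × T (tail v)) (m * n)
HasSize-∷ {S = S} {T} (L , L! , refl , ∈L⇔S) (M , M! , refl , ∈M⇔T) =
  cartesianProductWith _∷_ L M ,
  Unique.cartesianProductWith⁺ _∷_ Vec.∷-injective L! M! ,
  length-cartesianProductWith _∷_ L M ,
  λ { (x ∷ w) → mk⇔ ∈-cons⁻ (λ (Sx , Tw) →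
                  ∈-cartesianProductWith⁺ _∷_ (from (∈L⇔S x) Sx) (from (∈M⇔T w) Tw)) }
  where
  ∈-cons⁻ : ∀ {x w} → (x ∷ w) ∈ₗ cartesianProductWith _∷_ L M → S x × T w
  ∈-cons⁻ x∷w∈ with _ , _ , x∈L , w∈M , refl ← ∈-cartesianProductWith⁻ _∷_ L M x∷w∈ =
    to (∈L⇔S _) x∈L , to (∈M⇔T _) w∈M

length-filter-map : {B : Set} {P : Pred B 0ℓ} (P? : Decidable P) (f : A → B) (xs : List A) →
                    length (filter P? (map f xs)) ≡ length (filter (P? ∘ f) xs)
length-filter-map P? f []       = refl
length-filter-map P? f (x ∷ xs) with does (P? (f x))
... | true  = cong suc (length-filter-map P? f xs)
... | false = length-filter-map P? f xs

module _ {P : Pred (Fin (suc r)) 0ℓ} (P? : Decidable P) where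

  private
    length-filter-tail : length (filter P? (tabulate suc)) ≡ length (filter (P? ∘ suc) (allFin r))
    length-filter-tail = trans (cong (length ∘ filter P?) (sym (List.map-tabulate id suc)))
                               (length-filter-map P? suc (allFin r))

  length-filter-allFin-accept : P zero →
    length (filter P? (allFin (suc r))) ≡ suc (length (filter (P? ∘ suc) (allFin r)))
  length-filter-allFin-accept P0 = trans (cong length (List.filter-accept P? P0)) (cong suc length-filter-tail)

  length-filter-allFin-reject : ¬ P zero →
    length (filter P? (allFin (suc r))) ≡ length (filter (P? ∘ suc) (allFin r))
  length-filter-allFin-reject ¬P0 = trans (cong length (List.filter-reject P? ¬P0)) length-filter-tail

length-filter-initialSegment : ∀ {k} {P : Pred (Fin r) 0ℓ} (P? : Decidable P) →
  k ≤ r → (∀ i → P i ⇔ toℕ i < k) → length (filter P? (allFin r)) ≡ k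
length-filter-initialSegment {zero}  P? z≤n _ = refl
length-filter-initialSegment {suc r} {zero} P? z≤n P⇔ =
  trans (length-filter-allFin-reject P? (λ P0 → case to (P⇔ zero) P0 of λ ()))
        (length-filter-initialSegment (P? ∘ suc) z≤n
          (λ i → mk⇔ (λ P[1+i] → case to (P⇔ (suc i)) P[1+i] of λ ()) (λ ())))
length-filter-initialSegment {suc r} {suc k} P? (s≤s k≤r) P⇔ =
  trans (length-filter-allFin-accept P? (from (P⇔ zero) (s≤s z≤n)))
        (cong suc (length-filter-initialSegment (P? ∘ suc) k≤r
          (λ i → mk⇔ (s<s⁻¹ ∘ to (P⇔ (suc i))) (from (P⇔ (suc i)) ∘ s≤s))))

HasSize-box : (D : Fin r → Subset q) → (∀ i → ∣ D i ∣ ≡ 1 ⊎ ∣ D i ∣ ≡ 2) →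
  HasSize (λ v → ∀ i → lookup v i ∈ D i) (2 ^ length (filter (λ i → ∣ D i ∣ ≟ 2) (allFin r)))
HasSize-box {zero}  D _ = ([] ∷ []) , (All.[] ∷ []) , refl , λ { [] → mk⇔ (λ _ ()) (λ _ → here refl) }
HasSize-box {suc r} D sizes =
  HasSize-resp ∈head×∈tail⇔∈box size≡
    (HasSize-∷ (HasSize-∈ (D zero)) (HasSize-box (D ∘ suc) (sizes ∘ suc)))
  where
  ∣D∣≟2 = λ i → ∣ D i ∣ ≟ 2
  c = length (filter (∣D∣≟2 ∘ suc) (allFin r))
  ∈head×∈tail⇔∈box : ∀ v → (head v ∈ D zero × (∀ i → lookup (tail v) i ∈ D (suc i)))
                             ⇔ (∀ i → lookup v i ∈ D i)
  ∈head×∈tail⇔∈box (x ∷ w) =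
    mk⇔ (λ { (x∈ , w∈) zero → x∈ ; (x∈ , w∈) (suc i) → w∈ i }) (λ v∈ → v∈ zero , v∈ ∘ suc)
  size≡ : ∣ D zero ∣ * 2 ^ c ≡ 2 ^ length (filter ∣D∣≟2 (allFin (suc r)))
  size≡ with sizes zero
  ... | inj₁ ∣D₀∣≡1 = begin
    ∣ D zero ∣ * 2 ^ c                           ≡⟨ cong (_* 2 ^ c) ∣D₀∣≡1 ⟩
    1 * 2 ^ c                                    ≡⟨ ℕ.*-identityˡ (2 ^ c) ⟩
    2 ^ c                                        ≡⟨ cong (2 ^_) (length-filter-allFin-reject ∣D∣≟2 ∣D₀∣≢2) ⟨
    2 ^ length (filter ∣D∣≟2 (allFin (suc r)))   ∎
    where
    open ≡-Reasoning
    ∣D₀∣≢2 : ∣ D zero ∣ ≢ 2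
    ∣D₀∣≢2 ∣D₀∣≡2 = case trans (sym ∣D₀∣≡1) ∣D₀∣≡2 of λ ()
  ... | inj₂ ∣D₀∣≡2 =
    trans (cong (_* 2 ^ c) ∣D₀∣≡2) (cong (2 ^_) (sym (length-filter-allFin-accept ∣D∣≟2 ∣D₀∣≡2)))

OR-from-isolatedPoint : ∀ {k} (D : Fin r → Subset q) → (∀ i → ∣ D i ∣ ≡ 1 ⊎ ∣ D i ∣ ≡ 2) →
  length (filter (λ i → ∣ D i ∣ ≟ 2) (allFin r)) ≡ k →
  (U : Relation q r) (u : Vec (Fin q) r) → (∀ i → lookup u i ∈ D i) → U u →
  (∀ v → (∀ i → lookup v i ∈ D i) → U v → v ≡ u) →
  ORDefinable k (λ v → ¬ U v)
OR-from-isolatedPoint D sizes refl U u u∈D Uu isolated =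
  D , sizes , refl ,
  HasSize-resp (λ v → mk⇔ (λ (v∈D , v≢u) → v∈D , v≢u ∘ isolated v v∈D)
                          (λ (v∈D , ¬Uv) → v∈D , λ { refl → ¬Uv Uu }))
               refl
               (HasSize-remove (Vec.≡-dec Fin._≟_) (HasSize-box D sizes) u∈D)

Staircase : ℕ → (Fin n → ℕ) → Set
Staircase s f = ∀ i → f i ≡ s + toℕ i ⊎ f i ≡ suc (s + toℕ i)

Staircase-suc : ∀ {s} {f : Fin (suc n) → ℕ} → Staircase s f → Staircase (suc s) (f ∘ suc)
Staircase-suc {s = s} {f} f↗ i =
  subst (λ t → f (suc i) ≡ t ⊎ f (suc i) ≡ suc t) (ℕ.+-suc s (toℕ i)) (f↗ (suc i))

lowered-if-≤ : ∀ {x t} → x ≡ t ⊎ x ≡ suc t → x ≤ t → x ≡ t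
lowered-if-≤ (inj₁ x≡t) _   = x≡t
lowered-if-≤ (inj₂ refl) t<t = ⊥-elim (ℕ.<-irrefl refl t<t)

raised-if-> : ∀ {x t} → x ≡ t ⊎ x ≡ suc t → t < x → x ≡ suc t
raised-if-> (inj₁ refl) t<t = ⊥-elim (ℕ.<-irrefl refl t<t)
raised-if-> (inj₂ x≡1+t) _  = x≡1+t

staircase-lowered : ∀ {s} {f : Fin (suc n) → ℕ} → Injective _≡_ _≡_ f → Staircase s f →
                    f (fromℕ n) ≤ s + n → ∀ i → f i ≡ s + toℕ i
staircase-lowered {zero} _ f↗ fₙ≤ zero = lowered-if-≤ (f↗ zero) fₙ≤
staircase-lowered {suc n} {s} {f} inj f↗ fₙ≤ = lowered
  where
  tail-lowered : ∀ i → f (suc i) ≡ suc s + toℕ i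
  tail-lowered = staircase-lowered (Fin.suc-injective ∘ inj) (Staircase-suc f↗)
                   (subst (f (fromℕ (suc n)) ≤_) (ℕ.+-suc s n) fₙ≤)
  lowered : ∀ i → f i ≡ s + toℕ i
  lowered zero with f↗ zero
  ... | inj₁ f₀≡s   = f₀≡s
  ... | inj₂ f₀≡1+s = ⊥-elim (Fin.0≢1+n (inj (trans f₀≡1+s (sym (tail-lowered zero)))))
  lowered (suc i) = trans (tail-lowered i) (sym (ℕ.+-suc s (toℕ i)))

staircase-raised : ∀ {s} {f : Fin (suc n) → ℕ} → Injective _≡_ _≡_ f → Staircase s f →
                   s < f zero → ∀ i → f i ≡ suc (s + toℕ i)
staircase-raised {s = s} {f} inj f↗ s<f₀ zero =
  raised-if-> (f↗ zero) (subst (_< f zero) (sym (ℕ.+-identityʳ s)) s<f₀)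
staircase-raised {suc n} {s} {f} inj f↗ s<f₀ (suc i) =
  trans (tail-raised i) (cong suc (sym (ℕ.+-suc s (toℕ i))))
  where
  1+s<f₁ : suc s < f (suc zero)
  1+s<f₁ with Staircase-suc f↗ zero
  ... | inj₁ f₁≡1+s = ⊥-elim (Fin.0≢1+n (inj (trans (staircase-raised inj f↗ s<f₀ zero) (sym f₁≡1+s))))
  ... | inj₂ f₁≡2+s = subst (suc s <_) (sym f₁≡2+s) (s≤s (s≤s (ℕ.m≤m+n s 0)))
  tail-raised : ∀ i → f (suc i) ≡ suc (suc s + toℕ i)
  tail-raised = staircase-raised (Fin.suc-injective ∘ inj) (Staircase-suc f↗) 1+s<f₁

-- `UR q d ℓ v` is definitionally `IsUR (entry d ℓ v)`.
IsUR : ∀ {d ℓ} {A : Set} → (Fin d → Fin ℓ → A) → Set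
IsUR M = (∀ j → Injective _≡_ _≡_ (λ i → M i j)) × (∀ j j′ i → ∃ λ i′ → M i′ j′ ≡ M i j)

module _ {d ℓ : ℕ} where

  IsUR-map : {B : Set} {M : Fin d → Fin ℓ → A} (f : A → B) → Injective _≡_ _≡_ f →
             IsUR M → IsUR (λ i j → f (M i j))
  IsUR-map f f-inj (inj , ex) =
    (λ j → inj j ∘ f-inj) , λ j j′ i → proj₁ (ex j j′ i) , cong f (proj₂ (ex j j′ i))

  IsUR-cong : {M N : Fin d → Fin ℓ → A} → (∀ i j → M i j ≡ N i j) → IsUR M → IsUR N
  IsUR-cong M≡N (inj , ex) =
    (λ j e → inj j (trans (M≡N _ j) (trans e (sym (M≡N _ j))))) ,
    λ j j′ i → proj₁ (ex j j′ i) , trans (sym (M≡N _ j′)) (trans (proj₂ (ex j j′ i)) (M≡N i j))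

  IsUR-upperBound : ∀ {M : Fin d → Fin ℓ → ℕ} {b} j′ → IsUR M → (∀ i → M i j′ ≤ b) → ∀ i j → M i j ≤ b
  IsUR-upperBound j′ (_ , ex) M≤b i j with i′ , e ← ex j j′ i = subst (_≤ _) e (M≤b i′)

  IsUR-lowerBound : ∀ {M : Fin d → Fin ℓ → ℕ} {b} j′ → IsUR M → (∀ i → b ≤ M i j′) → ∀ i j → b ≤ M i j
  IsUR-lowerBound j′ (_ , ex) b≤M i j with i′ , e ← ex j j′ i = subst (_ ≤_) e (b≤M i′)

  toVec : (Fin d → Fin ℓ → A) → Vec A (d * ℓ)
  toVec M = Data.Vec.tabulate (λ p → uncurry M (remQuot {d} ℓ p))

  entry-toVec : ∀ {q} (M : Fin d → Fin ℓ → Fin q) i j → entry d ℓ (toVec M) i j ≡ M i j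
  entry-toVec M i j =
    trans (Vec.lookup∘tabulate _ (combine i j)) (cong (uncurry M) (Fin.remQuot-combine i j))

  ≡-toVec : ∀ {q} {v : Vec (Fin q) (d * ℓ)} {M} → (∀ i j → entry d ℓ v i j ≡ M i j) → v ≡ toVec M
  ≡-toVec {v = v} v≡M = trans (sym (Vec.tabulate∘lookup v)) (Vec.tabulate-cong λ p →
    let i , j = remQuot {d} ℓ p in
    trans (cong (lookup v) (sym (Fin.combine-remQuot {d} ℓ p))) (v≡M i j))

∣⁅x⁆∪⁅x⁆∣≡1 : (x : Fin n) → ∣ ⁅ x ⁆ ∪ ⁅ x ⁆ ∣ ≡ 1
∣⁅x⁆∪⁅x⁆∣≡1 x = trans (cong ∣_∣ (∪-idem ⁅ x ⁆)) (∣⁅x⁆∣≡1 x)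

∣⁅x⁆∪⁅y⁆∣≡2 : (x y : Fin n) → x ≢ y → ∣ ⁅ x ⁆ ∪ ⁅ y ⁆ ∣ ≡ 2
∣⁅x⁆∪⁅y⁆∣≡2 zero    zero    x≢y = ⊥-elim (x≢y refl)
∣⁅x⁆∪⁅y⁆∣≡2 zero    (suc y) _   = cong suc (trans (cong ∣_∣ (∪-identityˡ ⁅ y ⁆)) (∣⁅x⁆∣≡1 y))
∣⁅x⁆∪⁅y⁆∣≡2 (suc x) zero    _   = cong suc (trans (cong ∣_∣ (∪-identityʳ ⁅ x ⁆)) (∣⁅x⁆∣≡1 x))
∣⁅x⁆∪⁅y⁆∣≡2 (suc x) (suc y) x≢y = ∣⁅x⁆∪⁅y⁆∣≡2 x y (x≢y ∘ cong suc)

toℕ-mod : ∀ {x} .{{_ : NonZero n}} → x < n → toℕ (x mod n) ≡ x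
toℕ-mod x<n = trans (Fin.toℕ-fromℕ< _) (m<n⇒m%n≡m x<n)

-- Values enter Fin q through `_mod q`, which the bounds base<q and raised<q make injective on
-- every value that occurs.
module Layout {d ℓ q : ℕ} .{{_ : NonZero q}} (k : ℕ) (base : Fin d → Fin ℓ → ℕ)
  (base<q : ∀ i j → base i j < q)
  (raised<q : ∀ i j → toℕ (combine i j) < k → suc (base i j) < q) where

  Free : Fin d → Fin ℓ → Set
  Free i j = toℕ (combine i j) < k

  Allowed : Fin d → Fin ℓ → ℕ → Set
  Allowed i j x = x ≡ base i j ⊎ (Free i j × x ≡ suc (base i j))

  Fits : (Fin d → Fin ℓ → ℕ) → Set
  Fits E = ∀ i j → Allowed i j (E i j)

  top : Fin d → Fin ℓ → ℕ
  top i j with toℕ (combine i j) <? k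
  ... | yes _ = suc (base i j)
  ... | no _  = base i j

  side : Fin d → Fin ℓ → Subset q
  side i j = ⁅ base i j mod q ⁆ ∪ ⁅ top i j mod q ⁆

  box : Fin (d * ℓ) → Subset q
  box p = uncurry side (remQuot {d} ℓ p)

  top-free : ∀ {i j} → Free i j → top i j ≡ suc (base i j)
  top-free {i} {j} free with toℕ (combine i j) <? k
  ... | yes _    = refl
  ... | no ¬free = ⊥-elim (¬free free)

  top-fixed : ∀ {i j} → ¬ Free i j → top i j ≡ base i j
  top-fixed {i} {j} ¬free with toℕ (combine i j) <? k
  ... | yes free = ⊥-elim (¬free free)
  ... | no _     = refl

  ∣side∣≡2 : ∀ {i j} → Free i j → ∣ side i j ∣ ≡ 2
  ∣side∣≡2 {i} {j} free rewrite top-free free =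
    ∣⁅x⁆∪⁅y⁆∣≡2 _ _ (λ e → ℕ.1+n≢n (trans (sym (toℕ-mod (raised<q i j free)))
                                      (trans (cong toℕ (sym e)) (toℕ-mod (base<q i j)))))

  ∣side∣≡1 : ∀ {i j} → ¬ Free i j → ∣ side i j ∣ ≡ 1
  ∣side∣≡1 {i} {j} ¬free rewrite top-fixed ¬free = ∣⁅x⁆∪⁅x⁆∣≡1 (base i j mod q)

  ∣side∣≡2⇔Free : ∀ i j → (∣ side i j ∣ ≡ 2) ⇔ Free i j
  ∣side∣≡2⇔Free i j = mk⇔ (λ ∣side∣≡2 → decidable-stable (toℕ (combine i j) <? k)
                                            (λ ¬free → case trans (sym (∣side∣≡1 ¬free)) ∣side∣≡2 of λ ()))
                           ∣side∣≡2

  side-size : ∀ i j → ∣ side i j ∣ ≡ 1 ⊎ ∣ side i j ∣ ≡ 2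
  side-size i j = [ inj₂ ∘ ∣side∣≡2 , inj₁ ∘ ∣side∣≡1 ]′ (toSum (toℕ (combine i j) <? k))

  allowed-top : ∀ i j → Allowed i j (toℕ (top i j mod q))
  allowed-top i j with toℕ (combine i j) <? k
  ... | yes free = inj₂ (free , toℕ-mod (raised<q i j free))
  ... | no _     = inj₁ (toℕ-mod (base<q i j))

  ∈side⁻ : ∀ {i j x} → x ∈ side i j → Allowed i j (toℕ x)
  ∈side⁻ {i} {j} x∈ with x∈p∪q⁻ ⁅ base i j mod q ⁆ _ x∈
  ... | inj₁ x∈base = inj₁ (trans (cong toℕ (x∈⁅y⁆⇒x≡y _ x∈base)) (toℕ-mod (base<q i j)))
  ... | inj₂ x∈top  = subst (Allowed i j) (cong toℕ (sym (x∈⁅y⁆⇒x≡y _ x∈top))) (allowed-top i j)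

  ∈side⁺ : ∀ {i j x} → Allowed i j x → x mod q ∈ side i j
  ∈side⁺ (inj₁ refl)          = x∈p∪q⁺ (inj₁ (x∈⁅x⁆ _))
  ∈side⁺ (inj₂ (free , refl)) =
    x∈p∪q⁺ (inj₂ (subst (λ t → _ mod q ∈ ⁅ t mod q ⁆) (sym (top-free free)) (x∈⁅x⁆ _)))

  column-staircase : ∀ {E} j s → (∀ i → base i j ≡ s + toℕ i) → Fits E → Staircase s (λ i → E i j)
  column-staircase j s base≡ E-fits i with E-fits i j
  ... | inj₁ E≡base        = inj₁ (trans E≡base (base≡ i))
  ... | inj₂ (_ , E≡1+base) = inj₂ (trans E≡1+base (cong suc (base≡ i)))

  fixed-entry : ∀ {E i j} → Fits E → ¬ Free i j → E i j ≡ base i j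
  fixed-entry {i = i} {j} E-fits ¬free = [ id , (λ (free , _) → ⊥-elim (¬free free)) ]′ (E-fits i j)

  base≤ : ∀ {E} → Fits E → ∀ i j → base i j ≤ E i j
  base≤ E-fits i j with E-fits i j
  ... | inj₁ E≡base         = ℕ.≤-reflexive (sym E≡base)
  ... | inj₂ (_ , E≡1+base) = subst (_ ≤_) (sym E≡1+base) (ℕ.n≤1+n _)

  OR-from-rigidity : k ≤ d * ℓ → (target : Fin d → ℕ) → Injective _≡_ _≡_ target →
    Fits (λ i _ → target i) → (∀ E → Fits E → IsUR E → ∀ i j → E i j ≡ target i) →
    ORDefinable k (NUR q d ℓ)
  OR-from-rigidity k≤dℓ target target-inj target-fits rigid =
    OR-from-isolatedPoint box (λ p → uncurry side-size (remQuot {d} ℓ p)) count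
                          (UR q d ℓ) u u∈box u-UR isolated
    where
    u : Vec (Fin q) (d * ℓ)
    u = toVec (λ i _ → target i mod q)
    target<q : ∀ i j → target i < q
    target<q i j with target-fits i j
    ... | inj₁ t≡base            = subst (_< q) (sym t≡base) (base<q i j)
    ... | inj₂ (free , t≡1+base) = subst (_< q) (sym t≡1+base) (raised<q i j free)
    count : length (filter (λ p → ∣ box p ∣ ≟ 2) (allFin (d * ℓ))) ≡ k
    count = length-filter-initialSegment (λ p → ∣ box p ∣ ≟ 2) k≤dℓ λ p →
      let i , j = remQuot {d} ℓ p
          Free⇔ = subst (λ p′ → Free i j ⇔ (toℕ p′ < k)) (Fin.combine-remQuot {d} ℓ p) (mk⇔ id id)
      in mk⇔ (to Free⇔ ∘ to (∣side∣≡2⇔Free i j)) (from (∣side∣≡2⇔Free i j) ∘ from Free⇔)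
    u∈box : ∀ p → lookup u p ∈ box p
    u∈box p = subst (_∈ box p) (sym (Vec.lookup∘tabulate _ p)) (∈side⁺ (target-fits _ _))
    u-UR : UR q d ℓ u
    u-UR = IsUR-cong (λ i j → sym (entry-toVec _ i j))
      ( (λ j {i} {i′} e → target-inj (trans (sym (toℕ-mod (target<q i j)))
                                      (trans (cong toℕ e) (toℕ-mod (target<q i′ j)))))
      , λ _ _ i → i , refl)
    isolated : ∀ v → (∀ p → lookup v p ∈ box p) → UR q d ℓ v → v ≡ u
    isolated v v∈box v-UR = ≡-toVec λ i j → Fin.toℕ-injective
      (trans (rigid (λ i j → toℕ (entry d ℓ v i j)) E-fits (IsUR-map toℕ Fin.toℕ-injective v-UR) i j)
             (sym (toℕ-mod (target<q i j))))
      where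
      E-fits : Fits (λ i j → toℕ (entry d ℓ v i j))
      E-fits i j = ∈side⁻ (subst (λ ij → lookup v (combine i j) ∈ uncurry side ij)
                                 (Fin.remQuot-combine i j) (v∈box (combine i j)))

combine<⇒row< : ∀ {d ℓ m} (i : Fin d) (j : Fin ℓ) → toℕ (combine i j) < m * ℓ → toℕ i < m
combine<⇒row< {ℓ = ℓ} {m} i j ij<mℓ = ℕ.≰⇒> λ m≤i → ℕ.<⇒≱ ij<mℓ (begin
  m * ℓ               ≤⟨ ℕ.*-monoˡ-≤ ℓ m≤i ⟩
  toℕ i * ℓ           ≡⟨ ℕ.*-comm (toℕ i) ℓ ⟩
  ℓ * toℕ i           ≤⟨ ℕ.m≤m+n _ _ ⟩
  ℓ * toℕ i + toℕ j   ≡⟨ Fin.toℕ-combine i j ⟨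
  toℕ (combine i j)   ∎)
  where open ℕ.≤-Reasoning

toℕ-combine-last : ∀ m n → toℕ (combine (fromℕ m) (fromℕ n)) ≡ suc m * suc n ∸ 1
toℕ-combine-last m n = begin
  toℕ (combine (fromℕ m) (fromℕ n))          ≡⟨ Fin.toℕ-combine (fromℕ m) (fromℕ n) ⟩
  suc n * toℕ (fromℕ m) + toℕ (fromℕ n)
    ≡⟨ cong₂ (λ a b → suc n * a + b) (Fin.toℕ-fromℕ m) (Fin.toℕ-fromℕ n) ⟩
  suc n * m + n                              ≡⟨ ℕ.+-comm (suc n * m) n ⟩
  n + suc n * m                              ≡⟨ cong (n +_) (ℕ.*-comm (suc n) m) ⟩
  n + m * suc n                              ∎
  where open ≡-Reasoning

-- The last row is fixed, and it lowers every column to 0, …, d − 1.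
NUR-ORDefinable-[d∸1]*ℓ : ∀ {d ℓ q} → 1 ≤ d → d ≤ q → ORDefinable ((d ∸ 1) * ℓ) (NUR q d ℓ)
NUR-ORDefinable-[d∸1]*ℓ {suc d′} {ℓ} {suc q′} _ (s≤s d′≤q′) =
  OR-from-rigidity (ℕ.m≤n+m (d′ * ℓ) ℓ) toℕ Fin.toℕ-injective (λ _ _ → inj₁ refl) rigid
  where
  open Layout {suc d′} {ℓ} {suc q′} (d′ * ℓ) (λ i _ → toℕ i)
    (λ i _ → s≤s (ℕ.≤-trans (Fin.toℕ≤pred[n] i) d′≤q′))
    (λ i j free → s≤s (ℕ.≤-trans (combine<⇒row< i j free) d′≤q′))
  rigid : ∀ E → Fits E → IsUR E → ∀ i j → E i j ≡ toℕ i
  rigid E E-fits (inj , _) i j =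
    staircase-lowered (inj j) (column-staircase j 0 (λ _ → refl) E-fits) lastRow≤ i
    where
    lastRow≤ : E (fromℕ d′) j ≤ d′
    lastRow≤ = ℕ.≤-reflexive (trans (fixed-entry E-fits λ free →
                 ℕ.<-irrefl (Fin.toℕ-fromℕ d′) (combine<⇒row< (fromℕ d′) j free)) (Fin.toℕ-fromℕ d′))

-- Only the bottom-right entry is fixed; it lowers the last column to 0, …, d − 1, whose bound
-- d − 1 then lowers every other column.
NUR-ORDefinable-d*ℓ∸1 : ∀ {d ℓ q} → 1 ≤ d → 1 ≤ ℓ → d + 1 ≤ q → ORDefinable (d * ℓ ∸ 1) (NUR q d ℓ)
NUR-ORDefinable-d*ℓ∸1 {suc d′} {suc ℓ′} {suc q′} _ _ (s≤s d′+1≤q′) =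
  OR-from-rigidity (ℕ.m∸n≤m _ 1) toℕ Fin.toℕ-injective (λ _ _ → inj₁ refl) rigid
  where
  d≤q′ : suc d′ ≤ q′
  d≤q′ = subst (_≤ q′) (ℕ.+-comm d′ 1) d′+1≤q′
  open Layout {suc d′} {suc ℓ′} {suc q′} (suc d′ * suc ℓ′ ∸ 1) (λ i _ → toℕ i)
    (λ i _ → ℕ.m<n⇒m<1+n (ℕ.<-≤-trans (Fin.toℕ<n i) d≤q′))
    (λ i _ _ → s≤s (ℕ.<-≤-trans (Fin.toℕ<n i) d≤q′))
  corner-fixed : ¬ Free (fromℕ d′) (fromℕ ℓ′)
  corner-fixed = ℕ.<-irrefl (toℕ-combine-last d′ ℓ′)
  rigid : ∀ E → Fits E → IsUR E → ∀ i j → E i j ≡ toℕ i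
  rigid E E-fits E-UR@(inj , _) i j =
    staircase-lowered (inj j) (column-staircase j 0 (λ _ → refl) E-fits) lastRow≤ i
    where
    lastColumn : ∀ i → E i (fromℕ ℓ′) ≡ toℕ i
    lastColumn = staircase-lowered (inj (fromℕ ℓ′)) (column-staircase (fromℕ ℓ′) 0 (λ _ → refl) E-fits)
      (ℕ.≤-reflexive (trans (fixed-entry E-fits corner-fixed) (Fin.toℕ-fromℕ d′)))
    lastRow≤ : E (fromℕ d′) j ≤ d′
    lastRow≤ = IsUR-upperBound (fromℕ ℓ′) E-UR
      (λ i → subst (_≤ d′) (sym (lastColumn i)) (Fin.toℕ≤pred[n] i)) (fromℕ d′) j

-- Column 0 has sides {i, i + 1} and the others {i + 1, i + 2}. The positive entries of column 1
-- raise column 0 to 1, …, d, whose bound d then lowers every other column to 1, …, d.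
NUR-ORDefinable-d*ℓ : ∀ {d ℓ q} → 1 ≤ d → 2 ≤ ℓ → d + 2 ≤ q → ORDefinable (d * ℓ) (NUR q d ℓ)
NUR-ORDefinable-d*ℓ {ℓ = suc zero} _ (s≤s ()) _
NUR-ORDefinable-d*ℓ {suc d′} {suc (suc ℓ″)} {suc q′} _ _ (s≤s d′+2≤q′) =
  OR-from-rigidity ℕ.≤-refl (suc ∘ toℕ) (Fin.toℕ-injective ∘ ℕ.suc-injective) target-fits rigid
  where
  base : Fin (suc d′) → Fin (suc (suc ℓ″)) → ℕ
  base i zero    = toℕ i
  base i (suc _) = suc (toℕ i)
  base≤d : ∀ i j → base i j ≤ suc d′
  base≤d i zero    = ℕ.m≤n⇒m≤1+n (Fin.toℕ≤pred[n] i)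
  base≤d i (suc _) = s≤s (Fin.toℕ≤pred[n] i)
  base<q′ : ∀ i j → base i j < q′
  base<q′ i j = ℕ.≤-trans (s≤s (base≤d i j)) (subst (_≤ q′) (ℕ.+-comm d′ 2) d′+2≤q′)
  open Layout {suc d′} {suc (suc ℓ″)} {suc q′} (suc d′ * suc (suc ℓ″)) base
    (λ i j → ℕ.m<n⇒m<1+n (base<q′ i j)) (λ i j _ → s≤s (base<q′ i j))
  target-fits : Fits (λ i _ → suc (toℕ i))
  target-fits i zero    = inj₂ (Fin.toℕ<n (combine i zero) , refl)
  target-fits i (suc _) = inj₁ refl
  rigid : ∀ E → Fits E → IsUR E → ∀ i j → E i j ≡ suc (toℕ i)
  rigid E E-fits E-UR@(inj , _) = columns
    where
    firstColumn : ∀ i → E i zero ≡ suc (toℕ i)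
    firstColumn = staircase-raised (inj zero) (column-staircase zero 0 (λ _ → refl) E-fits)
      (IsUR-lowerBound (suc zero) E-UR
        (λ i → ℕ.<-≤-trans (s≤s z≤n) (base≤ E-fits i (suc zero))) zero zero)
    columns : ∀ i j → E i j ≡ suc (toℕ i)
    columns i zero    = firstColumn i
    columns i (suc j) =
      staircase-lowered (inj (suc j)) (column-staircase (suc j) 1 (λ _ → refl) E-fits) lastRow≤ i
      where
      lastRow≤ : E (fromℕ d′) (suc j) ≤ suc d′
      lastRow≤ = IsUR-upperBound zero E-UR
        (λ i → subst (_≤ suc d′) (sym (firstColumn i)) (s≤s (Fin.toℕ≤pred[n] i))) (fromℕ d′) (suc j)

lemma4p2 : ∀ (d ℓ : ℕ) → 1 ≤ d → 1 ≤ ℓ →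
    ((2 ≤ ℓ → ∀ (q : ℕ) → d + 2 ≤ q → ORDefinable (d * ℓ) (NUR q d ℓ))
    × (∀ (q : ℕ) → d + 1 ≤ q → ORDefinable (d * ℓ ∸ 1) (NUR q d ℓ))
    × (∀ (q : ℕ) → d ≤ q → ORDefinable ((d ∸ 1) * ℓ) (NUR q d ℓ)))
lemma4p2 d ℓ 1≤d 1≤ℓ =
  (λ 2≤ℓ q → NUR-ORDefinable-d*ℓ 1≤d 2≤ℓ) ,
  (λ q → NUR-ORDefinable-d*ℓ∸1 1≤d 1≤ℓ) ,
  (λ q → NUR-ORDefinable-[d∸1]*ℓ 1≤d)
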